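{- Let $q$ and $q+2$ be prime powers with $q\equiv 3\pmod 4$, let $\chi$ be the quadratic character of $\mathbb{F}_{q+2}^*$, and let $E$ and $F$ be inequivalent skew Hadamard difference sets in $(\mathbb{F}_q,+)$. Then the two difference sets $$D=\{(x,y)\mid x\in E,\ y\in\mathbb{F}_{q+2}^*,\ \chi(y)=1\}\cup\{(x,y)\mid x\in -E,\ y\in\mathbb{F}_{q+2}^*,\ \chi(y)=-1\}\cup\{(x,0)\mid x\in\mathbb{F}_q\}$$ and $$D'=\{(x,y)\mid x\in F,\ y\in\mathbb{F}_{q+2}^*,\ \chi(y)=1\}\cup\{(x,y)\mid x\in -F,\ y\in\mathbb{F}_{q+2}^*,\ \chi(y)=-1\}\cup\{(x,0)\mid x\in\mathbb{F}_q\}$$ in $G=(\mathbb{F}_q,+)\times(\mathbb{F}_{q+2},+)$ are inequivalent.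
   Context: A difference set $E$ in $(\mathbb{F}_q,+)$ is skew Hadamard if it is a difference set and $\mathbb{F}_q$ is the disjoint union of $E$, $-E$ and $\{0\}$. Two difference sets $D_1,D_2$ in an abelian group $G$ (written additively) are equivalent if there exist an automorphism $\sigma$ of $G$ and $g\in G$ with $\sigma(D_1)=D_2+g$. (The sets $D,D'$ above are difference sets in $G$ with parameters $(4n-1,2n-1,n-1)$, $n=(q+1)^2/4$.) -}

module Defs where

open import Level using (0ℓ)
open import Data.Bool using (Bool; true; false; _∧_; _∨_; not; if_then_else_)
open import Data.Nat using (ℕ; zero; suc; _^_; _≤_)
import Data.Nat as ℕ
open import Data.Nat.Primality using (Prime)
open import Data.Fin using (Fin)
import Data.Fin as Fin
open import Data.Fin.Properties using (*↔×)
open import Data.Integer using (ℤ; 1ℤ; 0ℤ; -1ℤ)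
import Data.Integer as ℤ
open import Data.Product using (Σ; ∃; _×_; _,_; proj₁; proj₂; Σ-syntax; ∃-syntax)
open import Data.Product.Properties using (≡-dec)
open import Data.Product.Function.NonDependent.Propositional using (_×-↔_)
open import Data.Sum using (_⊎_)
open import Relation.Nullary using (¬_; Dec; yes; no)
open import Relation.Nullary.Decidable using (⌊_⌋)
open import Relation.Binary.Definitions using (DecidableEquality)
open import Relation.Binary.PropositionalEquality
  using (_≡_; _≢_; refl; cong; cong₂; isEquivalence)
open import Function.Bundles using (_↔_; _⇔_; Inverse)
open import Function.Properties.Inverse using (↔-trans; ↔-sym)
open import Algebra.Structures using (IsAbelianGroup; IsCommutativeRing; IsGroup; IsMonoid; IsSemigroup; IsMagma)

IsPrimePower : ℕ → Set
IsPrimePower q = Σ ℕ λ p → Σ ℕ λ k → Prime p × 1 ≤ k × q ≡ p ^ k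

record FinAbGroup : Set₁ where
  infixl 6 _+_ _-_
  infix 8 -_
  field
    Carrier        : Set
    _+_            : Carrier → Carrier → Carrier
    0#             : Carrier
    -_             : Carrier → Carrier
    isAbelianGroup : IsAbelianGroup _≡_ _+_ 0# -_
    _≟_            : DecidableEquality Carrier
    size           : ℕ
    enum           : Carrier ↔ Fin size

  _-_ : Carrier → Carrier → Carrier
  x - y = x + (- y)

  elem : Fin size → Carrier
  elem = Inverse.from enum

sumFin : ∀ {n} → (Fin n → ℕ) → ℕ
sumFin {zero}  f = 0
sumFin {suc n} f = f Fin.zero ℕ.+ sumFin (λ i → f (Fin.suc i))

countFin : ∀ {n} → (Fin n → Bool) → ℕ
countFin P = sumFin (λ i → if P i then 1 else 0)

anyFin : ∀ {n} → (Fin n → Bool) → Bool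
anyFin {zero}  P = false
anyFin {suc n} P = P Fin.zero ∨ anyFin (λ i → P (Fin.suc i))

Subset : FinAbGroup → Set
Subset G = FinAbGroup.Carrier G → Bool

module _ (G : FinAbGroup) where
  open FinAbGroup G

  card : Subset G → ℕ
  card D = countFin (λ i → D (elem i))

  reps : Subset G → Carrier → ℕ
  reps D g = sumFin (λ i → countFin (λ j →
               D (elem i) ∧ D (elem j) ∧ ⌊ (elem i - elem j) ≟ g ⌋))

  IsDifferenceSetWith : ℕ → ℕ → ℕ → Subset G → Set
  IsDifferenceSetWith v k λ' D =
    size ≡ v × card D ≡ k × (∀ g → g ≢ 0# → reps D g ≡ λ')

  IsDifferenceSet : Subset G → Set
  IsDifferenceSet D = Σ ℕ λ k → Σ ℕ λ λ' → IsDifferenceSetWith size k λ' D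

  IsAutomorphism : (Carrier → Carrier) → Set
  IsAutomorphism σ =
    (∀ a b → σ (a + b) ≡ σ a + σ b) ×
    Σ (Carrier → Carrier) (λ τ → (∀ x → τ (σ x) ≡ x) × (∀ y → σ (τ y) ≡ y))

  -- D₁ and D₂ are equivalent: σ(D₁) = D₂ + g for an automorphism σ and g ∈ G
  Equivalent : Subset G → Subset G → Set
  Equivalent D₁ D₂ =
    Σ (Carrier → Carrier) λ σ → IsAutomorphism σ × Σ Carrier λ g →
      ∀ y → (Σ Carrier λ x → D₁ x ≡ true × σ x ≡ y)
          ⇔ (Σ Carrier λ d → D₂ d ≡ true × y ≡ d + g)

record FiniteField : Set₁ where
  infixl 6 _+_
  infixl 7 _*_
  infix 8 -_
  field
    Carrier           : Set
    _+_ _*_           : Carrier → Carrier → Carrier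
    -_                : Carrier → Carrier
    0# 1#             : Carrier
    isCommutativeRing : IsCommutativeRing _≡_ _+_ _*_ -_ 0# 1#
    0≢1               : 0# ≢ 1#
    inverse           : ∀ x → x ≢ 0# → Σ Carrier λ y → x * y ≡ 1#
    _≟_               : DecidableEquality Carrier
    size              : ℕ
    enum              : Carrier ↔ Fin size

  elem : Fin size → Carrier
  elem = Inverse.from enum

  additiveGroup : FinAbGroup
  additiveGroup = record
    { Carrier = Carrier ; _+_ = _+_ ; 0# = 0# ; -_ = -_
    ; isAbelianGroup = IsCommutativeRing.+-isAbelianGroup isCommutativeRing
    ; _≟_ = _≟_ ; size = size ; enum = enum }

  isSquare : Carrier → Bool
  isSquare y = anyFin (λ i → ⌊ (elem i * elem i) ≟ y ⌋)

  χ : Carrier → ℤ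
  χ y with y ≟ 0#
  ... | yes _ = 0ℤ
  ... | no  _ = if isSquare y then 1ℤ else -1ℤ

ExactlyOne : Set → Set → Set → Set
ExactlyOne P Q R = (P ⊎ Q ⊎ R) × ¬ (P × Q) × ¬ (P × R) × ¬ (Q × R)

module _ (K : FiniteField) where
  open FiniteField K

  IsSkewHadamard : Subset additiveGroup → Set
  IsSkewHadamard E =
    IsDifferenceSet additiveGroup E ×
    (∀ x → ExactlyOne (E x ≡ true) (E (- x) ≡ true) (x ≡ 0#))

_⊗_ : FinAbGroup → FinAbGroup → FinAbGroup
A ⊗ B = record
  { Carrier = A.Carrier × B.Carrier
  ; _+_ = λ { (a , b) (a' , b') → (a A.+ a') , (b B.+ b') }
  ; 0# = A.0# , B.0#
  ; -_ = λ { (a , b) → (A.- a) , (B.- b) }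
  ; isAbelianGroup = record
    { isGroup = record
      { isMonoid = record
        { isSemigroup = record
          { isMagma = record
            { isEquivalence = isEquivalence
            ; ∙-cong = λ { refl refl → refl } }
          ; assoc = λ { (a , b) (c , d) (e , f) →
              cong₂ _,_ (IA.assoc a c e) (IB.assoc b d f) } }
        ; identity =
            (λ { (a , b) → cong₂ _,_ (proj₁ IA.identity a) (proj₁ IB.identity b) }) ,
            (λ { (a , b) → cong₂ _,_ (proj₂ IA.identity a) (proj₂ IB.identity b) }) }
      ; inverse =
          (λ { (a , b) → cong₂ _,_ (proj₁ IA.inverse a) (proj₁ IB.inverse b) }) ,
          (λ { (a , b) → cong₂ _,_ (proj₂ IA.inverse a) (proj₂ IB.inverse b) })
      ; ⁻¹-cong = λ { refl → refl } }
    ; comm = λ { (a , b) (c , d) → cong₂ _,_ (IA.comm a c) (IB.comm b d) } }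
  ; _≟_ = ≡-dec A._≟_ B._≟_
  ; size = A.size ℕ.* B.size
  ; enum = ↔-trans (A.enum ×-↔ B.enum) (↔-sym *↔×)
  }
  where
    module A = FinAbGroup A
    module B = FinAbGroup B
    module IA = IsAbelianGroup A.isAbelianGroup
    module IB = IsAbelianGroup B.isAbelianGroup

module _ (K₁ K₂ : FiniteField) where
  private
    module K₁ = FiniteField K₁
    module K₂ = FiniteField K₂

  G : FinAbGroup
  G = K₁.additiveGroup ⊗ K₂.additiveGroup

  construction : Subset K₁.additiveGroup → Subset G
  construction E (x , y) =
      (E x ∧ not ⌊ y K₂.≟ K₂.0# ⌋ ∧ ⌊ K₂.χ y ℤ.≟ 1ℤ ⌋)
    ∨ (E (K₁.- x) ∧ not ⌊ y K₂.≟ K₂.0# ⌋ ∧ ⌊ K₂.χ y ℤ.≟ -1ℤ ⌋)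
    ∨ ⌊ y K₂.≟ K₂.0# ⌋

{-# OPTIONS --safe #-}
-- Since q is odd, the orders q and q + 2 of the factors of G = F_q × F_{q+2} are coprime, so an
-- automorphism σ of G maps each factor into itself and splits as σ₁ × σ₂.  Suppose
-- σ(D(E)) = D(F) + (g₁ , g₂).  The row F_q × {0} lies in D(E), while D(F) meets the column
-- {0} × F_{q+2} only in (0 , 0) because 0 ∉ F; this forces g₂ = 0.  The row of D(E) at
-- y₀ = σ₂⁻¹(1) is E or -E according to χ(y₀), and σ maps it onto the row of D(F) + g at 1,
-- which is F + g₁.  So σ₁ or σ₁ ∘ (-1) maps E onto F + g₁.
module Submission where

open import Defs
open import Data.Nat using (ℕ; _+_; _%_)
open import Data.Product using (_×_)
open import Relation.Nullary using (¬_)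
open import Relation.Binary.PropositionalEquality using (_≡_)

open import Level using (0ℓ)
open import Algebra.Bundles using (AbelianGroup)
import Algebra.Properties.AbelianGroup as AbelianGroupProperties
import Algebra.Properties.CommutativeMonoid.Sum as CommutativeMonoidSum
import Algebra.Properties.Group as GroupProperties
import Algebra.Properties.Monoid.Mult as MonoidMult
open import Algebra.Structures using (IsCommutativeRing)
open import Data.Bool using (Bool; true; false; _∧_; _∨_)
open import Data.Bool.Properties using (¬-not; ∧-identityʳ; ∧-zeroʳ; ∨-identityʳ; ∨-zeroʳ)
open import Data.Fin using (Fin)
import Data.Fin as Fin
open import Data.Fin.Permutation using (Permutation)
open import Data.Integer using (1ℤ; -1ℤ)
open import Data.Nat using (zero; suc)
import Data.Nat as ℕ
open import Data.Nat.Coprimality as Coprimality using (Coprime; coprime-Bézout; coprime-+)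
open import Data.Nat.DivMod using (m∣n⇒o%n%m≡o%m)
open import Data.Nat.Divisibility using (divides; n∣m⇒m%n≡0)
open import Data.Nat.GCD using (module Bézout)
open import Data.Nat.Primality using (prime[2]; prime⇒irreducible)
open import Data.Product using (Σ; _,_; proj₁; proj₂)
open import Data.Sum using (_⊎_; inj₁; inj₂)
open import Function using (_∘_; id)
open import Function.Bundles using (Inverse; Equivalence; mk⇔; mk↔ₛ′)
open import Function.Properties.Inverse using (↔-sym; ↔-trans)
open import Relation.Nullary using (yes; no; contradiction)
open import Relation.Nullary.Decidable using (dec-true; isYes≗does; decidable-stable)
open import Relation.Binary.PropositionalEquality
  using (_≢_; refl; sym; trans; cong; cong₂; subst; subst₂; module ≡-Reasoning)

open ≡-Reasoning

≡true⇔≡true⇒≡ : ∀ {a b : Bool} → (a ≡ true → b ≡ true) → (b ≡ true → a ≡ true) → a ≡ b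
≡true⇔≡true⇒≡ {false} {false} _   _   = refl
≡true⇔≡true⇒≡ {false} {true}  _   b⇒a = b⇒a refl
≡true⇔≡true⇒≡ {true}  {_}     a⇒b _   = sym (a⇒b refl)

anyFin-intro : ∀ {n} (P : Fin n → Bool) i → P i ≡ true → anyFin P ≡ true
anyFin-intro P Fin.zero    Pi = cong (_∨ anyFin (P ∘ Fin.suc)) Pi
anyFin-intro P (Fin.suc i) Pi with P Fin.zero
... | true  = refl
... | false = anyFin-intro (P ∘ Fin.suc) i Pi

odd⇒coprime[n,n+2] : ∀ {n} → n % 2 ≡ 1 → Coprime n (n + 2)
odd⇒coprime[n,n+2] {n} n%2≡1 = Coprimality.sym (coprime-+ coprime[2,n])
  where
  coprime[2,n] : Coprime 2 n
  coprime[2,n] (d∣2 , d∣n) with prime⇒irreducible prime[2] d∣2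
  ... | inj₁ d≡1  = d≡1
  ... | inj₂ refl = contradiction (trans (sym (n∣m⇒m%n≡0 n 2 d∣n)) n%2≡1) λ ()

module FinAbGroupProperties (A : FinAbGroup) where
  open FinAbGroup A renaming (_+_ to _⊕_)

  abelianGroup : AbelianGroup 0ℓ 0ℓ
  abelianGroup = record { isAbelianGroup = isAbelianGroup }

  open AbelianGroup abelianGroup public
    using (identityˡ; identityʳ; inverseʳ; group; commutativeMonoid; monoid)
  open GroupProperties group public
    using (∙-cancelˡ; ∙-cancelʳ; ε⁻¹≈ε; ⁻¹-involutive; \\-leftDividesˡ; \\-leftDividesʳ;
           //-rightDividesˡ; //-rightDividesʳ)
  open AbelianGroupProperties abelianGroup public using (⁻¹-∙-comm)
  open CommutativeMonoidSum commutativeMonoid public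
    using (sum; sum-cong-≗; sum-permute; ∑-distrib-+; sum-replicate)
  open MonoidMult monoid public using (×-assocˡ) renaming (_×_ to _·_)

  ·-zeroʳ : ∀ n → n · 0# ≡ 0#
  ·-zeroʳ zero    = refl
  ·-zeroʳ (suc n) = trans (identityˡ (n · 0#)) (·-zeroʳ n)

  translation : Carrier → Permutation size size
  translation x = ↔-trans (↔-sym enum)
    (↔-trans (mk↔ₛ′ (x ⊕_) (- x ⊕_) (\\-leftDividesˡ x) (\\-leftDividesʳ x)) enum)

  -- Translation by x permutes the elements, so their sum absorbs size · x.
  size·x≡0# : ∀ x → size · x ≡ 0#
  size·x≡0# x = ∙-cancelʳ (sum elem) (size · x) 0# (begin
    size · x ⊕ sum elem                      ≡⟨ cong (_⊕ sum elem) (sum-replicate size) ⟨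
    sum {size} (λ _ → x) ⊕ sum elem          ≡⟨ ∑-distrib-+ (λ _ → x) elem ⟨
    sum (λ i → x ⊕ elem i)                   ≡⟨ sum-cong-≗ (Inverse.strictlyInverseʳ enum ∘ (x ⊕_) ∘ elem) ⟨
    sum (elem ∘ Inverse.to (translation x))  ≡⟨ sum-permute elem (translation x) ⟨
    sum elem                                 ≡⟨ identityˡ (sum elem) ⟨
    0# ⊕ sum elem                            ∎)

  coprime-annihilators⇒≡0# : ∀ {m n x} → Coprime m n → m · x ≡ 0# → n · x ≡ 0# → x ≡ 0#
  coprime-annihilators⇒≡0# {m} {n} {x} coprime m·x≡0 n·x≡0 = fromBézout (coprime-Bézout coprime)
    where
    multiple : ∀ {k} c → k · x ≡ 0# → (c ℕ.* k) · x ≡ 0#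
    multiple {k} c k·x≡0 = trans (sym (×-assocˡ x c k)) (trans (cong (c ·_) k·x≡0) (·-zeroʳ c))
    bézout : ∀ {k l} → 1 + k ≡ l → k · x ≡ 0# → l · x ≡ 0# → x ≡ 0#
    bézout {k} {l} 1+k≡l k·x≡0 l·x≡0 = begin
      x           ≡⟨ identityʳ x ⟨
      x ⊕ 0#      ≡⟨ cong (x ⊕_) k·x≡0 ⟨
      suc k · x   ≡⟨ cong (_· x) 1+k≡l ⟩
      l · x       ≡⟨ l·x≡0 ⟩
      0#          ∎
    fromBézout : Bézout.Identity 1 m n → x ≡ 0#
    fromBézout (Bézout.+- a b 1+bn≡am) = bézout 1+bn≡am (multiple b n·x≡0) (multiple a m·x≡0)
    fromBézout (Bézout.-+ a b 1+am≡bn) = bézout 1+am≡bn (multiple a m·x≡0) (multiple b n·x≡0)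

IsHomomorphism : (A B : FinAbGroup) → (FinAbGroup.Carrier A → FinAbGroup.Carrier B) → Set
IsHomomorphism A B f = ∀ a b → f (a A.+ b) ≡ f a B.+ f b
  where
  module A = FinAbGroup A
  module B = FinAbGroup B

module HomomorphismProperties (A B : FinAbGroup) {f : FinAbGroup.Carrier A → FinAbGroup.Carrier B}
                              (f-hom : IsHomomorphism A B f) where
  private
    module A = FinAbGroup A
    module B = FinAbGroup B
    module A′ = FinAbGroupProperties A
    module B′ = FinAbGroupProperties B

  homomorphism-0# : f A.0# ≡ B.0#
  homomorphism-0# = B′.∙-cancelˡ (f A.0#) (f A.0#) B.0# (begin
    f A.0# B.+ f A.0#   ≡⟨ f-hom A.0# A.0# ⟨
    f (A.0# A.+ A.0#)   ≡⟨ cong f (A′.identityˡ A.0#) ⟩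
    f A.0#              ≡⟨ B′.identityʳ (f A.0#) ⟨
    f A.0# B.+ B.0#     ∎)

  homomorphism-· : ∀ n x → f (n A′.· x) ≡ n B′.· f x
  homomorphism-· zero    x = homomorphism-0#
  homomorphism-· (suc n) x = trans (f-hom x (n A′.· x)) (cong (f x B.+_) (homomorphism-· n x))

module EndomorphismProperties (A : FinAbGroup) where
  open FinAbGroup A using (Carrier; -_) renaming (_+_ to _⊕_)
  open FinAbGroupProperties A using (⁻¹-involutive; ⁻¹-∙-comm)

  inverse-isHomomorphism : ∀ {σ τ : Carrier → Carrier} → IsHomomorphism A A σ →
                           (∀ x → τ (σ x) ≡ x) → (∀ y → σ (τ y) ≡ y) → IsHomomorphism A A τ
  inverse-isHomomorphism {σ} {τ} σ-hom τ∘σ σ∘τ a b = begin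
    τ (a ⊕ b)               ≡⟨ cong τ (cong₂ _⊕_ (σ∘τ a) (σ∘τ b)) ⟨
    τ (σ (τ a) ⊕ σ (τ b))   ≡⟨ cong τ (σ-hom (τ a) (τ b)) ⟨
    τ (σ (τ a ⊕ τ b))       ≡⟨ τ∘σ (τ a ⊕ τ b) ⟩
    τ a ⊕ τ b               ∎

  id-isAutomorphism : IsAutomorphism A id
  id-isAutomorphism = (λ _ _ → refl) , id , (λ _ → refl) , (λ _ → refl)

  neg-isAutomorphism : IsAutomorphism A -_
  neg-isAutomorphism = (λ a b → sym (⁻¹-∙-comm a b)) , -_ , ⁻¹-involutive , ⁻¹-involutive

  ∘-isAutomorphism : ∀ {σ ρ} → IsAutomorphism A σ → IsAutomorphism A ρ → IsAutomorphism A (σ ∘ ρ)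
  ∘-isAutomorphism {σ} {ρ} (σ-hom , σ⁻¹ , σ⁻¹∘σ , σ∘σ⁻¹) (ρ-hom , ρ⁻¹ , ρ⁻¹∘ρ , ρ∘ρ⁻¹) =
    (λ a b → trans (cong σ (ρ-hom a b)) (σ-hom (ρ a) (ρ b))) ,
    ρ⁻¹ ∘ σ⁻¹ ,
    (λ x → trans (cong ρ⁻¹ (σ⁻¹∘σ (ρ x))) (ρ⁻¹∘ρ x)) ,
    (λ y → trans (cong σ (ρ∘ρ⁻¹ (σ⁻¹ y))) (σ∘σ⁻¹ y))

module _ (A : FinAbGroup) where
  open FinAbGroup A renaming (_+_ to _⊕_)
  open FinAbGroupProperties A using (//-rightDividesˡ; //-rightDividesʳ)

  Equivalent′ : Subset A → Subset A → Set
  Equivalent′ D₁ D₂ =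
    Σ (Carrier → Carrier) λ σ → IsAutomorphism A σ × Σ Carrier λ g → ∀ x → D₁ x ≡ D₂ (σ x - g)

  equivalent⇒equivalent′ : ∀ {D₁ D₂} → Equivalent A D₁ D₂ → Equivalent′ D₁ D₂
  equivalent⇒equivalent′ {D₁} {D₂} (σ , σ-aut@(_ , τ , τ∘σ , _) , g , image⇔translate) =
    σ , σ-aut , g , λ x → ≡true⇔≡true⇒≡ (forward x) (backward x)
    where
    forward : ∀ x → D₁ x ≡ true → D₂ (σ x - g) ≡ true
    forward x D₁x with d , D₂d , σx≡d+g ← Equivalence.to (image⇔translate (σ x)) (x , D₁x , refl) =
      subst (λ z → D₂ z ≡ true) (trans (sym (//-rightDividesʳ g d)) (cong (_- g) (sym σx≡d+g))) D₂d
    backward : ∀ x → D₂ (σ x - g) ≡ true → D₁ x ≡ true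
    backward x D₂[σx-g]
      with x′ , D₁x′ , σx′≡σx ← Equivalence.from (image⇔translate (σ x))
                                  (σ x - g , D₂[σx-g] , sym (//-rightDividesˡ g (σ x))) =
      subst (λ z → D₁ z ≡ true) (trans (sym (τ∘σ x′)) (trans (cong τ σx′≡σx) (τ∘σ x))) D₁x′

  equivalent′⇒equivalent : ∀ {D₁ D₂} → Equivalent′ D₁ D₂ → Equivalent A D₁ D₂
  equivalent′⇒equivalent {D₁} {D₂} (σ , σ-aut@(_ , τ , _ , σ∘τ) , g , D₁≡D₂) =
    σ , σ-aut , g , λ y → mk⇔ (forward y) (backward y)
    where
    forward : ∀ y → (Σ Carrier λ x → D₁ x ≡ true × σ x ≡ y) → (Σ Carrier λ d → D₂ d ≡ true × y ≡ d ⊕ g)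
    forward y (x , D₁x , σx≡y) =
      σ x - g , trans (sym (D₁≡D₂ x)) D₁x , trans (sym σx≡y) (sym (//-rightDividesˡ g (σ x)))
    backward : ∀ y → (Σ Carrier λ d → D₂ d ≡ true × y ≡ d ⊕ g) → (Σ Carrier λ x → D₁ x ≡ true × σ x ≡ y)
    backward y (d , D₂d , y≡d+g) = τ y , D₁[τy] , σ∘τ y
      where
      D₁[τy] : D₁ (τ y) ≡ true
      D₁[τy] = begin
        D₁ (τ y)           ≡⟨ D₁≡D₂ (τ y) ⟩
        D₂ (σ (τ y) - g)   ≡⟨ cong (λ z → D₂ (z - g)) (trans (σ∘τ y) y≡d+g) ⟩
        D₂ ((d ⊕ g) - g)   ≡⟨ cong D₂ (//-rightDividesʳ g d) ⟩
        D₂ d               ≡⟨ D₂d ⟩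
        true               ∎

module ProductProperties (A B : FinAbGroup) where
  private
    module A = FinAbGroupProperties A
    module B = FinAbGroupProperties B
    module A⊗B = FinAbGroupProperties (A ⊗ B)
  open FinAbGroup (A ⊗ B) using () renaming (_+_ to _⊕_)

  ·-⊗ : ∀ n a b → n A⊗B.· (a , b) ≡ (n A.· a , n B.· b)
  ·-⊗ zero    a b = refl
  ·-⊗ (suc n) a b = cong ((a , b) ⊕_) (·-⊗ n a b)

module CoprimeProduct (A B : FinAbGroup)
                      (coprime : Coprime (FinAbGroup.size A) (FinAbGroup.size B)) where
  private
    module A = FinAbGroup A
    module B = FinAbGroup B
    module A′ = FinAbGroupProperties A
    module B′ = FinAbGroupProperties B
    module A⊗B = FinAbGroupProperties (A ⊗ B)
  open FinAbGroup (A ⊗ B) using () renaming (_+_ to _⊕_)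
  open ProductProperties A B
  open EndomorphismProperties (A ⊗ B) using (inverse-isHomomorphism)

  -- f (x , 0) is killed by |A|, so its second coordinate is killed by the coprime |A| and |B|;
  -- symmetrically for f (0 , y).
  homomorphism-fixes-axisˡ : ∀ {f} → IsHomomorphism (A ⊗ B) (A ⊗ B) f →
                             ∀ x → f (x , B.0#) ≡ (proj₁ (f (x , B.0#)) , B.0#)
  homomorphism-fixes-axisˡ {f} f-hom x =
    cong (proj₁ v ,_) (B′.coprime-annihilators⇒≡0# coprime (cong proj₂ |A|·v≡0) (B′.size·x≡0# (proj₂ v)))
    where
    open HomomorphismProperties (A ⊗ B) (A ⊗ B) f-hom
    v = f (x , B.0#)
    |A|·v≡0 : (A.size A′.· proj₁ v , A.size B′.· proj₂ v) ≡ (A.0# , B.0#)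
    |A|·v≡0 = begin
      (A.size A′.· proj₁ v , A.size B′.· proj₂ v)  ≡⟨ ·-⊗ A.size (proj₁ v) (proj₂ v) ⟨
      A.size A⊗B.· f (x , B.0#)                    ≡⟨ homomorphism-· A.size (x , B.0#) ⟨
      f (A.size A⊗B.· (x , B.0#))                  ≡⟨ cong f (·-⊗ A.size x B.0#) ⟩
      f (A.size A′.· x , A.size B′.· B.0#)          ≡⟨ cong f (cong₂ _,_ (A′.size·x≡0# x) (B′.·-zeroʳ A.size)) ⟩
      f (A.0# , B.0#)                              ≡⟨ homomorphism-0# ⟩
      (A.0# , B.0#)                                ∎

  homomorphism-fixes-axisʳ : ∀ {f} → IsHomomorphism (A ⊗ B) (A ⊗ B) f →
                             ∀ y → f (A.0# , y) ≡ (A.0# , proj₂ (f (A.0# , y)))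
  homomorphism-fixes-axisʳ {f} f-hom y = cong (_, proj₂ v)
    (A′.coprime-annihilators⇒≡0# (Coprimality.sym coprime) (cong proj₁ |B|·v≡0) (A′.size·x≡0# (proj₁ v)))
    where
    open HomomorphismProperties (A ⊗ B) (A ⊗ B) f-hom
    v = f (A.0# , y)
    |B|·v≡0 : (B.size A′.· proj₁ v , B.size B′.· proj₂ v) ≡ (A.0# , B.0#)
    |B|·v≡0 = begin
      (B.size A′.· proj₁ v , B.size B′.· proj₂ v)  ≡⟨ ·-⊗ B.size (proj₁ v) (proj₂ v) ⟨
      B.size A⊗B.· f (A.0# , y)                    ≡⟨ homomorphism-· B.size (A.0# , y) ⟨
      f (B.size A⊗B.· (A.0# , y))                  ≡⟨ cong f (·-⊗ B.size A.0# y) ⟩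
      f (B.size A′.· A.0# , B.size B′.· y)          ≡⟨ cong f (cong₂ _,_ (A′.·-zeroʳ B.size) (B′.size·x≡0# y)) ⟩
      f (A.0# , B.0#)                              ≡⟨ homomorphism-0# ⟩
      (A.0# , B.0#)                                ∎

  module Splitting {σ τ : A.Carrier × B.Carrier → A.Carrier × B.Carrier}
                   (σ-hom : IsHomomorphism (A ⊗ B) (A ⊗ B) σ)
                   (τ∘σ : ∀ v → τ (σ v) ≡ v) (σ∘τ : ∀ v → σ (τ v) ≡ v) where
    private
      τ-hom : IsHomomorphism (A ⊗ B) (A ⊗ B) τ
      τ-hom = inverse-isHomomorphism σ-hom τ∘σ σ∘τ

    σˡ σˡ⁻¹ : A.Carrier → A.Carrier
    σˡ   x = proj₁ (σ (x , B.0#))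
    σˡ⁻¹ x = proj₁ (τ (x , B.0#))

    σʳ σʳ⁻¹ : B.Carrier → B.Carrier
    σʳ   y = proj₂ (σ (A.0# , y))
    σʳ⁻¹ y = proj₂ (τ (A.0# , y))

    σ-split : ∀ x y → σ (x , y) ≡ (σˡ x , σʳ y)
    σ-split x y = begin
      σ (x , y)                       ≡⟨ cong σ (cong₂ _,_ (A′.identityʳ x) (B′.identityˡ y)) ⟨
      σ ((x , B.0#) ⊕ (A.0# , y))     ≡⟨ σ-hom (x , B.0#) (A.0# , y) ⟩
      σ (x , B.0#) ⊕ σ (A.0# , y)     ≡⟨ cong₂ _⊕_ (homomorphism-fixes-axisˡ σ-hom x)
                                                   (homomorphism-fixes-axisʳ σ-hom y) ⟩
      (σˡ x , B.0#) ⊕ (A.0# , σʳ y)   ≡⟨ cong₂ _,_ (A′.identityʳ (σˡ x)) (B′.identityˡ (σʳ y)) ⟩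
      (σˡ x , σʳ y)                   ∎

    σˡ-isHomomorphism : IsHomomorphism A A σˡ
    σˡ-isHomomorphism a b =
      cong proj₁ (trans (cong (σ ∘ (a A.+ b ,_)) (sym (B′.identityˡ B.0#))) (σ-hom (a , B.0#) (b , B.0#)))

    σʳ-isHomomorphism : IsHomomorphism B B σʳ
    σʳ-isHomomorphism a b =
      cong proj₂ (trans (cong (σ ∘ (_, a B.+ b)) (sym (A′.identityˡ A.0#))) (σ-hom (A.0# , a) (A.0# , b)))

    σˡ⁻¹∘σˡ : ∀ x → σˡ⁻¹ (σˡ x) ≡ x
    σˡ⁻¹∘σˡ x = cong proj₁ (trans (cong τ (sym (homomorphism-fixes-axisˡ σ-hom x))) (τ∘σ (x , B.0#)))

    σˡ∘σˡ⁻¹ : ∀ x → σˡ (σˡ⁻¹ x) ≡ x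
    σˡ∘σˡ⁻¹ x = cong proj₁ (trans (cong σ (sym (homomorphism-fixes-axisˡ τ-hom x))) (σ∘τ (x , B.0#)))

    σʳ∘σʳ⁻¹ : ∀ y → σʳ (σʳ⁻¹ y) ≡ y
    σʳ∘σʳ⁻¹ y = cong proj₂ (trans (cong σ (sym (homomorphism-fixes-axisʳ τ-hom y))) (σ∘τ (A.0# , y)))

    σˡ-isAutomorphism : IsAutomorphism A σˡ
    σˡ-isAutomorphism = σˡ-isHomomorphism , σˡ⁻¹ , σˡ⁻¹∘σˡ , σˡ∘σˡ⁻¹

module FiniteFieldProperties (K : FiniteField) where
  open FiniteField K
  open IsCommutativeRing isCommutativeRing using (*-identityˡ)

  isSquare-1# : isSquare 1# ≡ true
  isSquare-1# = anyFin-intro _ i (trans (isYes≗does (i² ≟ 1#)) (dec-true (i² ≟ 1#) i²≡1))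
    where
    i = Inverse.to enum 1#
    i² = elem i * elem i
    i²≡1 : i² ≡ 1#
    i²≡1 = trans (cong (λ z → z * z) (Inverse.strictlyInverseʳ enum 1#)) (*-identityˡ 1#)

  χ-1# : χ 1# ≡ 1ℤ
  χ-1# with 1# ≟ 0#
  ... | yes 1≡0 = contradiction (sym 1≡0) 0≢1
  ... | no _ rewrite isSquare-1# = refl

  χ-nonzero : ∀ {y} → y ≢ 0# → χ y ≡ 1ℤ ⊎ χ y ≡ -1ℤ
  χ-nonzero {y} y≢0 with y ≟ 0#
  ... | yes y≡0 = contradiction y≡0 y≢0
  ... | no _ with isSquare y
  ...   | true  = inj₁ refl
  ...   | false = inj₂ refl

  skewHadamard⇒0∉ : ∀ {E} → IsSkewHadamard K E → E 0# ≡ false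
  skewHadamard⇒0∉ (_ , exactlyOne) =
    ¬-not λ E0≡true → proj₁ (proj₂ (proj₂ (exactlyOne 0#))) (E0≡true , refl)

module ConstructionProperties (K₁ K₂ : FiniteField) where
  private
    module K₁ = FiniteField K₁
    module K₂ = FiniteField K₂
    A = K₁.additiveGroup
    B = K₂.additiveGroup
    module B′ = FinAbGroupProperties B
    open FinAbGroupProperties A using (⁻¹-involutive; inverseʳ)
    open EndomorphismProperties A using (id-isAutomorphism; neg-isAutomorphism; ∘-isAutomorphism)
    open FiniteFieldProperties K₂ using (χ-1#; χ-nonzero)
    open FinAbGroup (G K₁ K₂) using (_-_)

  D : Subset A → Subset (G K₁ K₂)
  D = construction K₁ K₂

  construction-axis : ∀ E x → D E (x , K₂.0#) ≡ true
  construction-axis E x with K₂.0# K₂.≟ K₂.0#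
  ... | yes _  = trans (cong (E x ∧ false ∨_) (∨-zeroʳ (E (K₁.- x) ∧ false))) (∨-zeroʳ (E x ∧ false))
  ... | no 0≢0 = contradiction refl 0≢0

  construction-square : ∀ E x {y} → K₂.χ y ≡ 1ℤ → D E (x , y) ≡ E x
  construction-square E x {y} χy≡1 with y K₂.≟ K₂.0#
  construction-square E x {y} () | yes _
  ... | no _ rewrite χy≡1 =
    trans (cong₂ _∨_ (∧-identityʳ (E x)) (trans (∨-identityʳ _) (∧-zeroʳ (E (K₁.- x)))))
          (∨-identityʳ (E x))

  construction-nonsquare : ∀ E x {y} → K₂.χ y ≡ -1ℤ → D E (x , y) ≡ E (K₁.- x)
  construction-nonsquare E x {y} χy≡-1 with y K₂.≟ K₂.0#
  construction-nonsquare E x {y} () | yes _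
  ... | no _ rewrite χy≡-1 =
    cong₂ _∨_ (∧-zeroʳ (E x)) (trans (∨-identityʳ _) (∧-identityʳ (E (K₁.- x))))

  construction-row : ∀ {y} → y ≢ K₂.0# →
                     Σ (K₁.Carrier → K₁.Carrier) λ ν → IsAutomorphism A ν × ∀ E x → D E (ν x , y) ≡ E x
  construction-row y≢0 with χ-nonzero y≢0
  ... | inj₁ χy≡1  = id , id-isAutomorphism , λ E x → construction-square E x χy≡1
  ... | inj₂ χy≡-1 = K₁.-_ , neg-isAutomorphism ,
                     λ E x → trans (construction-nonsquare E (K₁.- x) χy≡-1) (cong E (⁻¹-involutive x))

  construction-column-0# : ∀ F {y} → F K₁.0# ≡ false → D F (K₁.0# , y) ≡ true → y ≡ K₂.0#
  construction-column-0# F {y} F0≡false D[0,y]≡true = decidable-stable (y K₂.≟ K₂.0#) ¬y≢0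
    where
    ¬y≢0 : ¬ y ≢ K₂.0#
    ¬y≢0 y≢0 with ν , (ν-hom , _) , row ← construction-row y≢0 = contradiction (begin
      false              ≡⟨ F0≡false ⟨
      F K₁.0#            ≡⟨ row F K₁.0# ⟨
      D F (ν K₁.0# , y)  ≡⟨ cong (λ x → D F (x , y)) (HomomorphismProperties.homomorphism-0# A A ν-hom) ⟩
      D F (K₁.0# , y)    ≡⟨ D[0,y]≡true ⟩
      true               ∎) λ ()

  module FromEquivalentConstructions
    (coprime : Coprime K₁.size K₂.size) {E F : Subset A} (F0≡false : F K₁.0# ≡ false)
    {σ τ : K₁.Carrier × K₂.Carrier → K₁.Carrier × K₂.Carrier}
    (σ-hom : IsHomomorphism (G K₁ K₂) (G K₁ K₂) σ)
    (τ∘σ : ∀ v → τ (σ v) ≡ v) (σ∘τ : ∀ v → σ (τ v) ≡ v)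
    (g₁ : K₁.Carrier) (g₂ : K₂.Carrier)
    (DE≡DF : ∀ v → D E v ≡ D F (σ v - (g₁ , g₂))) where
    open CoprimeProduct A B coprime
    open Splitting σ-hom τ∘σ σ∘τ

    σʳ-0# : σʳ K₂.0# ≡ K₂.0#
    σʳ-0# = HomomorphismProperties.homomorphism-0# B B σʳ-isHomomorphism

    g₂≡0 : g₂ ≡ K₂.0#
    g₂≡0 = begin
      g₂               ≡⟨ B′.⁻¹-involutive g₂ ⟨
      K₂.- (K₂.- g₂)   ≡⟨ cong K₂.-_ (construction-column-0# F F0≡false DF[0,-g₂]≡true) ⟩
      K₂.- K₂.0#       ≡⟨ B′.ε⁻¹≈ε ⟩
      K₂.0#            ∎
      where
      x₀ = σˡ⁻¹ g₁
      σ[x₀,0]-g≡[0,-g₂] : σ (x₀ , K₂.0#) - (g₁ , g₂) ≡ (K₁.0# , K₂.- g₂)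
      σ[x₀,0]-g≡[0,-g₂] = begin
        σ (x₀ , K₂.0#) - (g₁ , g₂)                     ≡⟨ cong (_- (g₁ , g₂)) (σ-split x₀ K₂.0#) ⟩
        (σˡ x₀ K₁.+ K₁.- g₁ , σʳ K₂.0# K₂.+ K₂.- g₂)   ≡⟨ cong₂ _,_ (cong (K₁._+ K₁.- g₁) (σˡ∘σˡ⁻¹ g₁))
                                                                    (cong (K₂._+ K₂.- g₂) σʳ-0#) ⟩
        (g₁ K₁.+ K₁.- g₁ , K₂.0# K₂.+ K₂.- g₂)         ≡⟨ cong₂ _,_ (inverseʳ g₁) (B′.identityˡ (K₂.- g₂)) ⟩
        (K₁.0# , K₂.- g₂)                              ∎
      DF[0,-g₂]≡true : D F (K₁.0# , K₂.- g₂) ≡ true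
      DF[0,-g₂]≡true = begin
        D F (K₁.0# , K₂.- g₂)            ≡⟨ cong (D F) σ[x₀,0]-g≡[0,-g₂] ⟨
        D F (σ (x₀ , K₂.0#) - (g₁ , g₂))  ≡⟨ DE≡DF (x₀ , K₂.0#) ⟨
        D E (x₀ , K₂.0#)                 ≡⟨ construction-axis E x₀ ⟩
        true                             ∎

    y₀ : K₂.Carrier
    y₀ = σʳ⁻¹ K₂.1#

    y₀≢0 : y₀ ≢ K₂.0#
    y₀≢0 y₀≡0 = K₂.0≢1 (begin
      K₂.0#      ≡⟨ σʳ-0# ⟨
      σʳ K₂.0#   ≡⟨ cong σʳ y₀≡0 ⟨
      σʳ y₀      ≡⟨ σʳ∘σʳ⁻¹ K₂.1# ⟩
      K₂.1#      ∎)

    σʳy₀-g₂≡1 : σʳ y₀ K₂.+ K₂.- g₂ ≡ K₂.1#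
    σʳy₀-g₂≡1 = begin
      σʳ y₀ K₂.+ K₂.- g₂      ≡⟨ cong₂ (λ a b → a K₂.+ K₂.- b) (σʳ∘σʳ⁻¹ K₂.1#) g₂≡0 ⟩
      K₂.1# K₂.+ K₂.- K₂.0#   ≡⟨ cong (K₂.1# K₂.+_) B′.ε⁻¹≈ε ⟩
      K₂.1# K₂.+ K₂.0#        ≡⟨ B′.identityʳ K₂.1# ⟩
      K₂.1#                   ∎

    equivalent′ : Equivalent′ A E F
    equivalent′ with ν , ν-isAutomorphism , row ← construction-row y₀≢0 =
      σˡ ∘ ν , ∘-isAutomorphism σˡ-isAutomorphism ν-isAutomorphism , g₁ , λ x → begin
        E x                                               ≡⟨ row E x ⟨
        D E (ν x , y₀)                                    ≡⟨ DE≡DF (ν x , y₀) ⟩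
        D F (σ (ν x , y₀) - (g₁ , g₂))                    ≡⟨ cong (λ v → D F (v - (g₁ , g₂))) (σ-split (ν x) y₀) ⟩
        D F (σˡ (ν x) K₁.+ K₁.- g₁ , σʳ y₀ K₂.+ K₂.- g₂)  ≡⟨ cong (λ y → D F (σˡ (ν x) K₁.+ K₁.- g₁ , y)) σʳy₀-g₂≡1 ⟩
        D F (σˡ (ν x) K₁.+ K₁.- g₁ , K₂.1#)               ≡⟨ construction-square F _ χ-1# ⟩
        F (σˡ (ν x) K₁.+ K₁.- g₁)                         ∎

  equivalent-constructions⇒equivalent : Coprime K₁.size K₂.size → ∀ {E F} → F K₁.0# ≡ false →
                                        Equivalent (G K₁ K₂) (D E) (D F) → Equivalent A E F
  equivalent-constructions⇒equivalent coprime {E} {F} F0≡false DE≈DF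
    with σ , (σ-hom , τ , τ∘σ , σ∘τ) , (g₁ , g₂) , DE≡DF ← equivalent⇒equivalent′ (G K₁ K₂) DE≈DF =
    equivalent′⇒equivalent A
      (FromEquivalentConstructions.equivalent′ coprime {E} {F} F0≡false σ-hom τ∘σ σ∘τ g₁ g₂ DE≡DF)

theorem5p3 : (q : ℕ) → IsPrimePower q → IsPrimePower (q + 2) → q % 4 ≡ 3 →
    (K₁ K₂ : FiniteField) → FiniteField.size K₁ ≡ q → FiniteField.size K₂ ≡ q + 2 →
    (E F : Subset (FiniteField.additiveGroup K₁)) →
    IsSkewHadamard K₁ E → IsSkewHadamard K₁ F →
    ¬ Equivalent (FiniteField.additiveGroup K₁) E F →
    ¬ Equivalent (G K₁ K₂) (construction K₁ K₂ E) (construction K₁ K₂ F)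
theorem5p3 q _ _ q%4≡3 K₁ K₂ |K₁|≡q |K₂|≡q+2 E F _ F-skewHadamard ¬E≈F =
  ¬E≈F ∘ equivalent-constructions⇒equivalent coprime {E} {F} (skewHadamard⇒0∉ F-skewHadamard)
  where
  open ConstructionProperties K₁ K₂ using (equivalent-constructions⇒equivalent)
  open FiniteFieldProperties K₁ using (skewHadamard⇒0∉)
  q%2≡1 : q % 2 ≡ 1
  q%2≡1 = trans (sym (m∣n⇒o%n%m≡o%m 2 4 q (divides 2 refl))) (cong (_% 2) q%4≡3)
  coprime : Coprime (FiniteField.size K₁) (FiniteField.size K₂)
  coprime = subst₂ Coprime (sym |K₁|≡q) (sym |K₂|≡q+2) (odd⇒coprime[n,n+2] q%2≡1)
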